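{- Let $\nu>0$ and $\delta\ge0$, and let $G$ be a bipartite graph with $|L(G)|=m$. Let $\mathcal L$ be the set of maximal stable sets $A$ of $G$ with $|A\cap L(G)|\ge(\tfrac12+\delta)m$, and let $\mathcal S$ be the set of maximal stable sets $B$ of $G$ with $|B\cap L(G)|\le(1-\nu)\tfrac m2$. If $|\mathcal S|\ge\tfrac1\nu|\mathcal L|$, then \[\sum_{A\in\mathcal A(G)}\frac{|A\cap L(G)|}{|\mathcal A(G)|}\le\left(\tfrac12+\delta\right)m.\]
   Context: All graphs are finite and simple; a bipartite graph has a fixed bipartition $(L(G),R(G))$. A vertex set is stable if no two of its vertices are adjacent, and maximally stable if moreover every vertex outside it has a neighbour in it. $\mathcal A(G)$ denotes the set of maximal stable sets of $G$.
   Formalization: The parameters ν > 0 and δ ≥ 0 range over the rationals. -}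

module Defs where

open import Data.Bool using (Bool; true; false; T)
open import Data.Nat using (ℕ; _+_)
open import Data.Fin using (Fin)
open import Data.Fin.Subset using (Subset; _∈_; _∉_; ∣_∣)
open import Data.Fin.Subset.Properties using (_∈?_)
open import Data.Fin.Properties using (all?; any?)
open import Data.Vec using (Vec; []; _∷_)
open import Data.List using (List; []; _∷_; map; _++_; filter; cartesianProduct; length; sum)
open import Data.Product using (_×_; _,_; proj₁; proj₂; ∃)
open import Relation.Nullary using (Dec; yes; no; ¬_)
open import Relation.Nullary.Decidable using (_×-dec_; _→-dec_; ¬?)
open import Relation.Binary.PropositionalEquality using (_≡_)
open import Data.Bool.Properties using () renaming (_≟_ to _≟B_)

-- A (finite, simple) bipartite graph with fixed bipartition (L(G), R(G)),
-- L(G) = Fin m, R(G) = Fin r.  Edges only go between L and R, so the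
-- graph is determined by the bipartite adjacency relation  adj i j  (i ∈ L, j ∈ R).
record BipGraph (m r : ℕ) : Set where
  field
    adj : Fin m → Fin r → Bool

open BipGraph public

-- A vertex set of G: its part in L(G) and its part in R(G).
VSet : ℕ → ℕ → Set
VSet m r = Subset m × Subset r

-- Stable: no two vertices of the set are adjacent (only L–R pairs can be adjacent).
Stable : ∀ {m r} → BipGraph m r → VSet m r → Set
Stable G (X , Y) = ∀ i j → i ∈ X → j ∈ Y → adj G i j ≡ false

MaxStable : ∀ {m r} → BipGraph m r → VSet m r → Set
MaxStable G (X , Y) =
  Stable G (X , Y)
  × (∀ i → i ∉ X → ∃ λ j → j ∈ Y × adj G i j ≡ true)
  × (∀ j → j ∉ Y → ∃ λ i → i ∈ X × adj G i j ≡ true)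

maxStable? : ∀ {m r} (G : BipGraph m r) (A : VSet m r) → Dec (MaxStable G A)
maxStable? G (X , Y) =
  (all? λ i → all? λ j → (i ∈? X) →-dec ((j ∈? Y) →-dec (adj G i j ≟B false)))
  ×-dec (all? λ i → ¬? (i ∈? X) →-dec any? λ j → (j ∈? Y) ×-dec (adj G i j ≟B true))
  ×-dec (all? λ j → ¬? (j ∈? Y) →-dec any? λ i → (i ∈? X) ×-dec (adj G i j ≟B true))

allSubsets : ∀ n → List (Subset n)
allSubsets ℕ.zero = [] ∷ []
allSubsets (ℕ.suc n) = map (true ∷_) (allSubsets n) ++ map (false ∷_) (allSubsets n)

-- 𝒜(G): the list (without repetition) of all maximal stable sets of G.
𝒜 : ∀ {m r} → BipGraph m r → List (VSet m r)
𝒜 {m} {r} G = filter (maxStable? G) (cartesianProduct (allSubsets m) (allSubsets r))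

sizeL : ∀ {m r} → VSet m r → ℕ
sizeL (X , _) = ∣ X ∣

module Submission where

-- Put T = (½ + δ)m, h = m/2 and k = νh.  Every maximal stable
-- set A obeys the pointwise bound
--     |A ∩ L| + k·[A ∈ 𝒮]  ≤  T + h·[A ∈ ℒ] :
-- a set in 𝒮 has |A ∩ L| ≤ (1 - ν)h = h - k ≤ T - k, a set in ℒ has
-- |A ∩ L| ≤ m ≤ T + h, and any other set has |A ∩ L| < T.  Summing over 𝒜(G)
-- gives  Σ|A ∩ L| + k|𝒮| ≤ T|𝒜(G)| + h|ℒ|,  while the hypothesis
-- (1/ν)|ℒ| ≤ |𝒮| says exactly h|ℒ| ≤ k|𝒮|; cancelling yields the claim.

open import Defs
open import Data.Nat using (ℕ)
open import Data.List using (List; filter; length; map)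
open import Data.Nat.ListAction using (sum)
open import Data.Integer using (+_)
open import Data.Rational using (ℚ; _/_; _≤_; _+_; _-_; _*_; ½; 1ℚ; 1/_; Positive; NonNegative)
open import Data.Rational.Properties using (_≤?_; pos⇒nonZero)

import Data.Nat as ℕ
import Data.Integer as ℤ
import Data.Integer.Properties as ℤ
import Data.Rational.Unnormalised as ℚᵘ
import Data.Rational.Unnormalised.Properties as ℚᵘ
open import Data.Rational using (mkℚ; 0ℚ; *≤*; -_; nonNegative; toℚᵘ)
open import Data.Rational.Properties
  using ( normalize-coprime; toℚᵘ-injective; toℚᵘ-homo-+; +-*-commutativeRing; _≟_
        ; ≤-refl; ≤-trans; ≤-reflexive; <⇒≤; ≰⇒>; +-mono-≤; +-monoˡ-≤; +-monoʳ-≤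
        ; *-monoˡ-≤-nonNeg; +-identityˡ; +-identityʳ; *-identityˡ; *-identityʳ; *-zeroʳ; *-distribˡ-+; *-inverseʳ
        ; nonNegative⁻¹; positive⁻¹; nonNeg*nonNeg⇒nonNeg; module ≤-Reasoning )
open import Data.Nat.Coprimality using (1-coprimeTo)
import Data.Nat.Coprimality as Coprime
open import Data.Fin.Subset.Properties using (∣p∣≤n)
open import Data.List using ([]; _∷_)
open import Data.Product using (_,_)
open import Relation.Nullary using (yes; no; Dec)
open import Relation.Unary using (Pred; Decidable)
open import Relation.Binary.PropositionalEquality
  using (_≡_; refl; sym; trans; cong; cong₂; subst; module ≡-Reasoning)
open import Relation.Nullary.Decidable using (dec⇒maybe)
open import Tactic.RingSolver.Core.AlmostCommutativeRing using (AlmostCommutativeRing; fromCommutativeRing)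
open import Tactic.RingSolver using (solve-∀)

ℚ-ring : AlmostCommutativeRing _ _
ℚ-ring = fromCommutativeRing +-*-commutativeRing (λ x → dec⇒maybe (0ℚ ≟ x))

toℚ : ℕ → ℚ
toℚ n = + n / 1

-- n/1 is already in lowest terms, so it is the rational with numerator n.
toℚ-mkℚ : ∀ n → toℚ n ≡ mkℚ (+ n) 0 (Coprime.sym (1-coprimeTo n))
toℚ-mkℚ n = normalize-coprime (Coprime.sym (1-coprimeTo n))

toℚ-+ : ∀ a b → toℚ (a ℕ.+ b) ≡ toℚ a + toℚ b
toℚ-+ a b = toℚᵘ-injective (begin
    toℚᵘ (toℚ (a ℕ.+ b))                ≡⟨ cong toℚᵘ (toℚ-mkℚ (a ℕ.+ b)) ⟩
    ℚᵘ.mkℚᵘ (+ (a ℕ.+ b)) 0              ≈⟨ ℚᵘ.*≡* numerators ⟩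
    ℚᵘ.mkℚᵘ (+ a) 0 ℚᵘ.+ ℚᵘ.mkℚᵘ (+ b) 0 ≡⟨ cong₂ ℚᵘ._+_ (cong toℚᵘ (sym (toℚ-mkℚ a)))
                                                          (cong toℚᵘ (sym (toℚ-mkℚ b))) ⟩
    toℚᵘ (toℚ a) ℚᵘ.+ toℚᵘ (toℚ b)       ≈⟨ ℚᵘ.≃-sym (toℚᵘ-homo-+ (toℚ a) (toℚ b)) ⟩
    toℚᵘ (toℚ a + toℚ b)                 ∎)
  where
  open import Relation.Binary.Reasoning.Setoid ℚᵘ.≃-setoid
  numerators : + (a ℕ.+ b) ℤ.* + 1 ≡ (+ a ℤ.* + 1 ℤ.+ + b ℤ.* + 1) ℤ.* + 1
  numerators rewrite ℤ.*-identityʳ (+ (a ℕ.+ b)) | ℤ.*-identityʳ (+ a)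
                   | ℤ.*-identityʳ (+ b) | ℤ.*-identityʳ (+ a ℤ.+ + b) = ℤ.pos-+ a b

toℚ-suc : ∀ n → toℚ (ℕ.suc n) ≡ 1ℚ + toℚ n
toℚ-suc = toℚ-+ 1

toℚ-mono : ∀ {a b} → a ℕ.≤ b → toℚ a ≤ toℚ b
toℚ-mono {a} {b} a≤b rewrite toℚ-mkℚ a | toℚ-mkℚ b =
  *≤* (ℤ.*-monoʳ-≤-nonNeg (+ 1) (ℤ.+≤+ a≤b))

Σ : {A : Set} → (A → ℚ) → List A → ℚ
Σ f []       = 0ℚ
Σ f (x ∷ xs) = f x + Σ f xs

𝟙 : ∀ {ℓ} {X : Set ℓ} → Dec X → ℚ
𝟙 (yes _) = 1ℚ
𝟙 (no _)  = 0ℚ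

module _ {A : Set} where

  Σ-+ : (f g : A → ℚ) (xs : List A) → Σ (λ x → f x + g x) xs ≡ Σ f xs + Σ g xs
  Σ-+ f g []       = refl
  Σ-+ f g (x ∷ xs) = trans (cong (_+_ (f x + g x)) (Σ-+ f g xs))
                           (interchange (f x) (g x) (Σ f xs) (Σ g xs))
    where
    interchange : ∀ a b c d → (a + b) + (c + d) ≡ (a + c) + (b + d)
    interchange = solve-∀ ℚ-ring

  Σ-scale : (c : ℚ) (f : A → ℚ) (xs : List A) → Σ (λ x → c * f x) xs ≡ c * Σ f xs
  Σ-scale c f []       = sym (*-zeroʳ c)
  Σ-scale c f (x ∷ xs) = trans (cong (_+_ (c * f x)) (Σ-scale c f xs))
                               (sym (*-distribˡ-+ c (f x) (Σ f xs)))

  Σ-const : (c : ℚ) (xs : List A) → Σ (λ _ → c) xs ≡ c * toℚ (length xs)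
  Σ-const c []       = sym (*-zeroʳ c)
  Σ-const c (x ∷ xs) = begin
    c + Σ (λ _ → c) xs       ≡⟨ cong (_+_ c) (Σ-const c xs) ⟩
    c + c * toℚ (length xs)  ≡⟨ distrib c (toℚ (length xs)) ⟩
    c * (1ℚ + toℚ (length xs)) ≡⟨ cong (c *_) (sym (toℚ-suc (length xs))) ⟩
    c * toℚ (length (x ∷ xs)) ∎
    where
    open ≡-Reasoning
    distrib : ∀ c n → c + c * n ≡ c * (1ℚ + n)
    distrib = solve-∀ ℚ-ring

  Σ-toℚ : (size : A → ℕ) (xs : List A) → Σ (λ x → toℚ (size x)) xs ≡ toℚ (sum (map size xs))
  Σ-toℚ size []       = refl
  Σ-toℚ size (x ∷ xs) = trans (cong (_+_ (toℚ (size x))) (Σ-toℚ size xs))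
                              (sym (toℚ-+ (size x) (sum (map size xs))))

  Σ-𝟙 : ∀ {ℓ} {P : Pred A ℓ} (P? : Decidable P) (xs : List A) →
        Σ (λ x → 𝟙 (P? x)) xs ≡ toℚ (length (filter P? xs))
  Σ-𝟙 P? []       = refl
  Σ-𝟙 P? (x ∷ xs) with P? x
  ... | yes _ = trans (cong (_+_ 1ℚ) (Σ-𝟙 P? xs)) (sym (toℚ-suc (length (filter P? xs))))
  ... | no _  = trans (+-identityˡ _) (Σ-𝟙 P? xs)

  Σ-mono : {f g : A → ℚ} → (∀ x → f x ≤ g x) → (xs : List A) → Σ f xs ≤ Σ g xs
  Σ-mono f≤g []       = ≤-refl
  Σ-mono f≤g (x ∷ xs) = +-mono-≤ (f≤g x) (Σ-mono f≤g xs)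

0≤* : ∀ {a b} → 0ℚ ≤ a → 0ℚ ≤ b → 0ℚ ≤ a * b
0≤* {a} {b} 0≤a 0≤b = nonNegative⁻¹ (a * b) {{nonNeg*nonNeg⇒nonNeg a {{nonNegative 0≤a}} b {{nonNegative 0≤b}}}}

≤-+ʳ : ∀ {a b} → 0ℚ ≤ b → a ≤ a + b
≤-+ʳ {a} {b} 0≤b = subst (_≤ a + b) (+-identityʳ a) (+-monoʳ-≤ a 0≤b)

+-cancel-≤ : ∀ {a b x y} → a + x ≤ b + y → y ≤ x → a ≤ b
+-cancel-≤ {a} {b} {x} {y} a+x≤b+y y≤x = begin
  a             ≡⟨ sym (add-sub a x) ⟩
  a + x - x     ≤⟨ +-monoˡ-≤ (- x) (≤-trans a+x≤b+y (+-monoʳ-≤ b y≤x)) ⟩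
  b + x - x     ≡⟨ add-sub b x ⟩
  b             ∎
  where
  open ≤-Reasoning
  add-sub : ∀ a x → a + x - x ≡ a
  add-sub = solve-∀ ℚ-ring

reciprocal-bound : ∀ ν .{{_ : Positive ν}} {h a b} → 0ℚ ≤ h →
                   (1/ ν) {{pos⇒nonZero ν}} * a ≤ b → h * a ≤ (ν * h) * b
reciprocal-bound ν {h} {a} {b} 0≤h a/ν≤b = begin
  h * a                                  ≡⟨ sym (*-identityʳ (h * a)) ⟩
  (h * a) * 1ℚ                           ≡⟨ cong (_*_ (h * a)) (sym (*-inverseʳ ν {{pos⇒nonZero ν}})) ⟩
  (h * a) * (ν * ν⁻¹)                    ≡⟨ regroup ν ν⁻¹ h a ⟩
  (ν * h) * (ν⁻¹ * a)                    ≤⟨ *-monoˡ-≤-nonNeg (ν * h) {{nonNegative 0≤νh}} a/ν≤b ⟩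
  (ν * h) * b                            ∎
  where
  open ≤-Reasoning
  ν⁻¹ = (1/ ν) {{pos⇒nonZero ν}}
  0≤νh : 0ℚ ≤ ν * h
  0≤νh = 0≤* (<⇒≤ (positive⁻¹ ν)) 0≤h
  regroup : ∀ ν w h a → (h * a) * (ν * w) ≡ (ν * h) * (w * a)
  regroup = solve-∀ ℚ-ring

zero-summand : ∀ a b → a + b * 0ℚ ≡ a
zero-summand a b = trans (cong (_+_ a) (*-zeroʳ b)) (+-identityʳ a)

pointwise-bound : ∀ {s M T h k c} → s ≤ M → c + k ≤ h → h ≤ T → M ≤ T + h → 0ℚ ≤ T →
                  s + k * 𝟙 (s ≤? c) ≤ T + h * 𝟙 (T ≤? s)
pointwise-bound {s} {M} {T} {h} {k} {c} s≤M c+k≤h h≤T M≤T+h 0≤T with s ≤? c | T ≤? s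
... | yes s≤c | yes _ = begin
  s + k * 1ℚ  ≡⟨ cong (_+_ s) (*-identityʳ k) ⟩
  s + k       ≤⟨ ≤-trans (+-monoˡ-≤ k s≤c) c+k≤h ⟩
  h           ≤⟨ subst (_≤ T + h) (+-identityˡ h) (+-monoˡ-≤ h 0≤T) ⟩
  T + h       ≡⟨ cong (_+_ T) (sym (*-identityʳ h)) ⟩
  T + h * 1ℚ  ∎
  where open ≤-Reasoning
... | yes s≤c | no _ = begin
  s + k * 1ℚ  ≡⟨ cong (_+_ s) (*-identityʳ k) ⟩
  s + k       ≤⟨ ≤-trans (+-monoˡ-≤ k s≤c) c+k≤h ⟩
  h           ≤⟨ h≤T ⟩
  T           ≡⟨ sym (zero-summand T h) ⟩
  T + h * 0ℚ  ∎
  where open ≤-Reasoning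
... | no _ | yes _ = begin
  s + k * 0ℚ  ≡⟨ zero-summand s k ⟩
  s           ≤⟨ s≤M ⟩
  M           ≤⟨ M≤T+h ⟩
  T + h       ≡⟨ cong (_+_ T) (sym (*-identityʳ h)) ⟩
  T + h * 1ℚ  ∎
  where open ≤-Reasoning
... | no _ | no s≱T = begin
  s + k * 0ℚ  ≡⟨ zero-summand s k ⟩
  s           ≤⟨ <⇒≤ (≰⇒> s≱T) ⟩
  T           ≡⟨ sym (zero-summand T h) ⟩
  T + h * 0ℚ  ∎
  where open ≤-Reasoning

complement-split : ∀ ν h → (1ℚ - ν) * h + ν * h ≡ h
complement-split = solve-∀ ℚ-ring

half≤threshold : ∀ {M δ} → 0ℚ ≤ M → 0ℚ ≤ δ → M * ½ ≤ (½ + δ) * M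
half≤threshold {M} {δ} 0≤M 0≤δ = subst (M * ½ ≤_) (sym (expand ½ δ M)) (≤-+ʳ (0≤* 0≤δ 0≤M))
  where
  expand : ∀ x δ M → (x + δ) * M ≡ M * x + δ * M
  expand = solve-∀ ℚ-ring

whole≤threshold+half : ∀ {M δ} → 0ℚ ≤ M → 0ℚ ≤ δ → M ≤ (½ + δ) * M + M * ½
whole≤threshold+half {M} {δ} 0≤M 0≤δ = begin
  M                       ≡⟨ sym (*-identityˡ M) ⟩
  1ℚ * M                  ≤⟨ ≤-+ʳ (0≤* 0≤δ 0≤M) ⟩
  (½ + ½) * M + δ * M     ≡⟨ sym (expand ½ δ M) ⟩
  (½ + δ) * M + M * ½     ∎
  where
  open ≤-Reasoning
  expand : ∀ x δ M → (x + δ) * M + M * x ≡ (x + x) * M + δ * M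
  expand = solve-∀ ℚ-ring

module _ {A : Set} {ℓ₁ ℓ₂} {P : Pred A ℓ₁} {Q : Pred A ℓ₂}
         (P? : Decidable P) (Q? : Decidable Q) (f : A → ℚ) (T h k : ℚ)
         (bound : ∀ a → f a + k * 𝟙 (Q? a) ≤ T + h * 𝟙 (P? a)) where

  private
    #_ : ∀ {ℓ} {R : Pred A ℓ} → Decidable R → List A → ℚ
    (# R?) xs = toℚ (length (filter R? xs))

  summed-bound : ∀ xs → Σ f xs + k * (# Q?) xs ≤ T * toℚ (length xs) + h * (# P?) xs
  summed-bound xs = begin
    Σ f xs + k * (# Q?) xs                      ≡⟨ cong (λ n → Σ f xs + k * n) (sym (Σ-𝟙 Q? xs)) ⟩
    Σ f xs + k * Σ 𝟙Q xs                        ≡⟨ cong (_+_ (Σ f xs)) (sym (Σ-scale k 𝟙Q xs)) ⟩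
    Σ f xs + Σ (λ a → k * 𝟙Q a) xs              ≡⟨ sym (Σ-+ f (λ a → k * 𝟙Q a) xs) ⟩
    Σ (λ a → f a + k * 𝟙Q a) xs                 ≤⟨ Σ-mono bound xs ⟩
    Σ (λ a → T + h * 𝟙P a) xs                   ≡⟨ Σ-+ (λ _ → T) (λ a → h * 𝟙P a) xs ⟩
    Σ (λ _ → T) xs + Σ (λ a → h * 𝟙P a) xs      ≡⟨ cong₂ _+_ (Σ-const T xs) (Σ-scale h 𝟙P xs) ⟩
    T * toℚ (length xs) + h * Σ 𝟙P xs           ≡⟨ cong (λ n → T * toℚ (length xs) + h * n) (Σ-𝟙 P? xs) ⟩
    T * toℚ (length xs) + h * (# P?) xs         ∎
    where
    open ≤-Reasoning
    𝟙P 𝟙Q : A → ℚ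
    𝟙P a = 𝟙 (P? a)
    𝟙Q a = 𝟙 (Q? a)

  average-bound : ∀ xs → h * (# P?) xs ≤ k * (# Q?) xs → Σ f xs ≤ T * toℚ (length xs)
  average-bound xs = +-cancel-≤ (summed-bound xs)

lemma6 : ∀ {m r : ℕ} (G : BipGraph m r) (ν δ : ℚ) .{{ν>0 : Positive ν}} → NonNegative δ →
    let ℒ = filter (λ A → ((½ + δ) * (+ m / 1)) ≤? (+ sizeL A / 1)) (𝒜 G)
        𝒮 = filter (λ B → (+ sizeL B / 1) ≤? ((1ℚ - ν) * ((+ m / 1) * ½))) (𝒜 G)
    in ((1/ ν) {{pos⇒nonZero ν}} * (+ length ℒ / 1)) ≤ (+ length 𝒮 / 1) →
       (+ sum (map sizeL (𝒜 G)) / 1) ≤ ((½ + δ) * (+ m / 1)) * (+ length (𝒜 G) / 1)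
lemma6 {m} {r} G ν δ δ≥0 |ℒ|/ν≤|𝒮| =
  subst (_≤ T * toℚ (length (𝒜 G))) (Σ-toℚ sizeL (𝒜 G))
    (average-bound P? Q? (λ A → toℚ (sizeL A)) T h (ν * h) pointwise (𝒜 G)
      (reciprocal-bound ν 0≤h |ℒ|/ν≤|𝒮|))
  where
  M h T : ℚ
  M = toℚ m
  h = M * ½
  T = (½ + δ) * M
  P? : (A : VSet m r) → Dec (T ≤ toℚ (sizeL A))
  P? A = T ≤? toℚ (sizeL A)
  Q? : (A : VSet m r) → Dec (toℚ (sizeL A) ≤ (1ℚ - ν) * h)
  Q? A = toℚ (sizeL A) ≤? (1ℚ - ν) * h
  0≤M : 0ℚ ≤ M
  0≤M = toℚ-mono {0} {m} ℕ.z≤n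
  0≤δ : 0ℚ ≤ δ
  0≤δ = nonNegative⁻¹ δ {{δ≥0}}
  0≤h : 0ℚ ≤ h
  0≤h = 0≤* 0≤M (*≤* (ℤ.+≤+ ℕ.z≤n))  -- 0 ≤ ½ by comparing numerators
  h≤T : h ≤ T
  h≤T = half≤threshold 0≤M 0≤δ
  -- Each maximal stable set satisfies the pointwise bound, since |A ∩ L| ≤ m.
  pointwise : ∀ A → toℚ (sizeL A) + (ν * h) * 𝟙 (Q? A) ≤ T + h * 𝟙 (P? A)
  pointwise (X , _) =
    pointwise-bound {k = ν * h} {c = (1ℚ - ν) * h}
      (toℚ-mono (∣p∣≤n X)) (≤-reflexive (complement-split ν h))
      h≤T (whole≤threshold+half 0≤M 0≤δ) (≤-trans 0≤h h≤T)
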